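{- Let $n,k$ be positive integers such that $s^{n,k}=\frac{n(n+1)}{2k}$ is an integer, and let $p_1\le p_2\le\cdots\le p_l$ be positive integers with $l<k$ such that (i) $n-\sum_{i=1}^l p_i\ge (k-l)p_l$, and (ii) for all $j\le l$, $\sum_{i=1}^{p_1+\cdots+p_j}(n-i+1)-j\,s^{n,k}\ge 0$. Then there exist integers $p_{l+1},\ldots,p_k$ such that $\mathcal P=[p_1,\ldots,p_k]$ is an ascending partition of $n$ of size $k$ with $\mathrm{slack}(\mathcal P)\ge 0$.
   Context: An ascending partition of $n$ of size $k$ is a sequence of positive integers $p_1\le\cdots\le p_k$ with $\sum_i p_i=n$. For such $\mathcal P$ and $j=1,\ldots,k$, $\mathrm{slack}_j(\mathcal P)=\sum_{i=1}^{p_1+\cdots+p_j}(n-i+1)-j\,s^{n,k}$, and $\mathrm{slack}(\mathcal P)=\min_{1\le j\le k-1}\mathrm{slack}_j(\mathcal P)$. -}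

module Defs where

open import Data.Nat as ℕ using (ℕ; zero; suc)
open import Data.Integer as ℤ using (ℤ; +_)
open import Data.List using (List; []; _∷_; take; length)
open import Data.Nat.ListAction using (sum)
open import Data.List.Relation.Unary.All using (All)
open import Data.List.Relation.Unary.Linked using (Linked)
open import Data.Product using (_×_)
open import Relation.Binary.PropositionalEquality using (_≡_)

headSum : ℕ → ℕ → ℤ
headSum n zero    = + 0
headSum n (suc m) = headSum n m ℤ.+ ((+ n ℤ.- + suc m) ℤ.+ + 1)

prefixSum : ℕ → List ℕ → ℕ
prefixSum j ps = sum (take j ps)

slackAt : (n s : ℕ) → List ℕ → ℕ → ℤ
slackAt n s ps j = headSum n (prefixSum j ps) ℤ.- (+ j ℤ.* + s)

AscendingSeq : List ℕ → Set
AscendingSeq ps = All (λ x → 0 ℕ.< x) ps × Linked ℕ._≤_ ps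

AscendingPartition : ℕ → ℕ → List ℕ → Set
AscendingPartition n k ps = AscendingSeq ps × sum ps ≡ n × length ps ≡ k

SlackNonneg : (n s : ℕ) → List ℕ → Set
SlackNonneg n s ps = ∀ j → 1 ℕ.≤ j → j ℕ.< length ps → + 0 ℤ.≤ slackAt n s ps j

{-# OPTIONS --safe #-}
-- Let A = p₁ + ⋯ + p_l, r = n − A and M = k − l, and complete p by d = M − b parts a = ⌊r/M⌋
-- followed by b = r mod M parts a + 1; (i) gives a ≥ p_l.  Since 2·Σ_{i≤x}(n − i + 1) equals
-- x(2n + 1 − x), the condition slack_{l+t} ≥ 0 is polynomial in the t-th prefix sum u_t of the
-- tail.  As slack_l ≥ 0 and slack_k = 0, interpolating linearly between j = l and j = k reduces
-- it to t·F(r) ≤ M·F(u_t) for the concave F(u) = u(2r + 1 − u).  The tail is balanced, so the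
-- deficit t·r − M·u_t is only t·b before the parts a + 1 start and d·(M − t) after, which the
-- concavity of F absorbs.
module Submission where

open import Defs
open import Data.Nat as ℕ using (ℕ; zero; suc; _+_; _*_; _∸_; _≤_; _<_; z≤n; s≤s; _≤?_; NonZero; >-nonZero)
open import Data.Nat.Properties
open import Data.Nat.DivMod using (_/_; _%_; m%n<n; m≡m%n+[m/n]*n; m*n/n≡m; /-monoˡ-≤)
open import Data.Nat.ListAction using (sum)
open import Data.Nat.ListAction.Properties using (sum-++)
open import Data.Nat.Tactic.RingSolver using (solve; solve-∀)
open import Data.Integer as ℤ using (+_)
import Data.Integer.Properties as ℤ
open import Data.List using (List; []; _∷_; _++_; length; last; head; take; drop; replicate)
open import Data.List.Properties using (length-replicate; length-++; take++drop≡id; take-all)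
import Data.List.Relation.Unary.All as All
import Data.List.Relation.Unary.All.Properties as Allₚ
open import Data.List.Relation.Unary.Linked as Linked using (Linked)
import Data.List.Relation.Unary.Linked.Properties as Linkedₚ
open import Data.Maybe using (just)
open import Data.Maybe.Relation.Binary.Connected using (Connected)
import Data.Maybe.Relation.Unary.All as Maybe
open import Data.Product using (_×_; ∃; _,_)
open import Function.Bundles using (_⇔_; mk⇔; Equivalence)
open import Relation.Nullary using (yes; no)
open import Relation.Binary.PropositionalEquality
  using (_≡_; refl; sym; trans; cong; cong₂; subst; subst₂; module ≡-Reasoning)

twiceHeadSum : ℕ → ℕ → ℕ
twiceHeadSum x y = x * (x + 2 * y + 1)

headSum-+ : ∀ x y → + 2 ℤ.* headSum (x + y) x ≡ + twiceHeadSum x y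
headSum-+ zero    y = refl
headSum-+ (suc x) y = begin
  + 2 ℤ.* (headSum (suc x + y) x ℤ.+ ((+ (suc x + y) ℤ.- + suc x) ℤ.+ + 1))
    ≡⟨ cong₂ (λ n i → + 2 ℤ.* (headSum n x ℤ.+ i)) (sym (+-suc x y)) last-term ⟩
  + 2 ℤ.* (headSum (x + suc y) x ℤ.+ + suc y)
    ≡⟨ ℤ.*-distribˡ-+ (+ 2) (headSum (x + suc y) x) (+ suc y) ⟩
  + 2 ℤ.* headSum (x + suc y) x ℤ.+ + (2 * suc y)
    ≡⟨ cong (ℤ._+ + (2 * suc y)) (headSum-+ x (suc y)) ⟩
  + (x * (x + 2 * suc y + 1) + 2 * suc y)
    ≡⟨ cong +_ (solve (x ∷ y ∷ [])) ⟩
  + (suc x * (suc x + 2 * y + 1)) ∎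
  where
  open ≡-Reasoning
  last-term : (+ (suc x + y) ℤ.- + suc x) ℤ.+ + 1 ≡ + suc y
  last-term = begin
    (+ (suc x + y) ℤ.- + suc x) ℤ.+ + 1 ≡⟨ cong (ℤ._+ + 1) (ℤ.m-n≡m⊖n (suc x + y) (suc x)) ⟩
    (suc x + y ℤ.⊖ suc x) ℤ.+ + 1       ≡⟨ cong (ℤ._+ + 1) (ℤ.⊖-≥ (m≤m+n (suc x) y)) ⟩
    + (suc x + y ∸ suc x) ℤ.+ + 1        ≡⟨ cong (λ z → + (z + 1)) (m+n∸m≡n (suc x) y) ⟩
    + (y + 1)                            ≡⟨ cong +_ (+-comm y 1) ⟩
    + suc y                              ∎

0≤headSum-js⇔ : ∀ x y j s →
  (+ 0 ℤ.≤ headSum (x + y) x ℤ.- + j ℤ.* + s) ⇔ (2 * (j * s) ≤ twiceHeadSum x y)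
0≤headSum-js⇔ x y j s = mk⇔
  (λ 0≤slack → ℤ.drop‿+≤+ (subst₂ ℤ._≤_ (sym 2js≡) (headSum-+ x y)
     (ℤ.*-monoˡ-≤-nonNeg (+ 2) (ℤ.0≤i-j⇒j≤i 0≤slack))))
  (λ 2js≤ → ℤ.i≤j⇒0≤j-i (ℤ.*-cancelˡ-≤-pos _ _ (+ 2)
     (subst₂ ℤ._≤_ 2js≡ (sym (headSum-+ x y)) (ℤ.+≤+ 2js≤))))
  where
  2js≡ : + (2 * (j * s)) ≡ + 2 ℤ.* (+ j ℤ.* + s)
  2js≡ = trans (ℤ.pos-* 2 (j * s)) (cong (+ 2 ℤ.*_) (ℤ.pos-* j s))

m≤n-o⇒m+o≤n : ∀ {m n o} → + m ℤ.≤ + n ℤ.- + o → m + o ≤ n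
m≤n-o⇒m+o≤n {m} {n} {o} m≤n-o = ℤ.drop‿+≤+ (begin
  + (m + o)                 ≡⟨ ℤ.pos-+ m o ⟩
  + m ℤ.+ + o               ≤⟨ ℤ.+-monoˡ-≤ (+ o) m≤n-o ⟩
  + n ℤ.- + o ℤ.+ + o       ≡⟨ ℤ.+-assoc (+ n) (ℤ.- + o) (+ o) ⟩
  + n ℤ.+ (ℤ.- + o ℤ.+ + o) ≡⟨ cong (λ z → + n ℤ.+ z) (ℤ.+-inverseˡ (+ o)) ⟩
  + n ℤ.+ + 0               ≡⟨ ℤ.+-identityʳ (+ n) ⟩
  + n                       ∎)
  where open ℤ.≤-Reasoning

n*m≤o⇒m≤o/n : ∀ m n o .{{_ : NonZero n}} → n * m ≤ o → m ≤ o / n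
n*m≤o⇒m≤o/n m n o nm≤o =
  subst (_≤ o / n) (m*n/n≡m m n) (/-monoˡ-≤ n (subst (_≤ o) (*-comm n m) nm≤o))

m*[n+1]≤m*[m+n] : ∀ m n → m * (n + 1) ≤ m * (m + n)
m*[n+1]≤m*[m+n] zero    n = z≤n
m*[n+1]≤m*[m+n] (suc m) n =
  *-monoʳ-≤ (suc m) (subst (_≤ suc m + n) (+-comm 1 n) (s≤s (m≤n+m n m)))

-- With r = sum q and u_t the t-th prefix sum of q, the points (t, F(u_t)), F(u) = u(2r + 1 − u),
-- lie on or above the chord from (0, 0) to (length q, F(r)).
AboveChord : List ℕ → Set
AboveChord q = ∀ t → t ≤ length q →
  let u = sum (take t q); v = sum (drop t q) in
  t * ((u + v) * (u + v + 1)) ≤ length q * twiceHeadSum u v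

chord-interpolation : ∀ {l t M s A u v} .{{_ : NonZero M}} → t ≤ M →
  2 * (l * s) ≤ twiceHeadSum A (u + v) →
  2 * ((l + M) * s) ≡ (A + (u + v)) * (A + (u + v) + 1) →
  t * ((u + v) * (u + v + 1)) ≤ M * twiceHeadSum u v →
  2 * ((l + t) * s) ≤ twiceHeadSum (A + u) v
chord-interpolation {l} {t} {M} {s} {A} {u} {v} t≤M slack-l slack-k chord
  with t' , refl ← m≤n⇒∃[o]m+o≡n t≤M = *-cancelˡ-≤ (t + t') (begin
  (t + t') * (2 * ((l + t) * s))
    ≡⟨ solve (t ∷ t' ∷ l ∷ s ∷ []) ⟩
  t' * (2 * (l * s)) + t * (2 * ((l + (t + t')) * s))
    ≤⟨ +-mono-≤ (*-monoʳ-≤ t' slack-l) (≤-reflexive (cong (t *_) slack-k)) ⟩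
  t' * (A * (A + 2 * (u + v) + 1)) + t * ((A + (u + v)) * (A + (u + v) + 1))
    ≡⟨ solve (t ∷ t' ∷ A ∷ u ∷ v ∷ []) ⟩
  (t + t') * (A * (A + 2 * (u + v) + 1)) + t * ((u + v) * (u + v + 1))
    ≤⟨ +-monoʳ-≤ ((t + t') * twiceHeadSum A (u + v)) chord ⟩
  (t + t') * (A * (A + 2 * (u + v) + 1)) + (t + t') * (u * (u + 2 * v + 1))
    ≡⟨ solve (t ∷ t' ∷ A ∷ u ∷ v ∷ []) ⟩
  (t + t') * ((A + u) * (A + u + 2 * v + 1)) ∎)
  where open ≤-Reasoning

chord-from-deficit : ∀ {t M u v δ} → t * (u + v) ≡ M * u + δ → δ * (u + v + 1) ≤ M * u * v →
  t * ((u + v) * (u + v + 1)) ≤ M * twiceHeadSum u v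
chord-from-deficit {t} {M} {u} {v} {δ} tr≡ δ-small = +-cancelʳ-≤ (M * u * v) _ _ (begin
  t * ((u + v) * (u + v + 1)) + M * u * v   ≡⟨ solve (t ∷ M ∷ u ∷ v ∷ []) ⟩
  t * (u + v) * (u + v + 1) + M * u * v     ≡⟨ cong (λ z → z * (u + v + 1) + M * u * v) tr≡ ⟩
  (M * u + δ) * (u + v + 1) + M * u * v     ≡⟨ solve (M ∷ u ∷ v ∷ δ ∷ []) ⟩
  M * (u * (u + 2 * v + 1)) + δ * (u + v + 1) ≤⟨ +-monoʳ-≤ (M * twiceHeadSum u v) δ-small ⟩
  M * (u * (u + 2 * v + 1)) + M * u * v      ∎)
  where open ≤-Reasoning

sum-replicate : ∀ n x → sum (replicate n x) ≡ n * x
sum-replicate zero    x = refl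
sum-replicate (suc n) x = cong (λ z → x + z) (sum-replicate n x)

take-replicate : ∀ {A : Set} t c (x : A) → take t (replicate (t + c) x) ≡ replicate t x
take-replicate zero    c x = refl
take-replicate (suc t) c x = cong (x ∷_) (take-replicate t c x)

drop-replicate : ∀ {A : Set} t c (x : A) → drop t (replicate (t + c) x) ≡ replicate c x
drop-replicate zero    c x = refl
drop-replicate (suc t) c x = drop-replicate t c x

take-++ˡ : ∀ {A : Set} j (xs ys : List A) → j ≤ length xs → take j (xs ++ ys) ≡ take j xs
take-++ˡ zero    xs       ys _         = refl
take-++ˡ (suc j) (x ∷ xs) ys (s≤s j≤l) = cong (x ∷_) (take-++ˡ j xs ys j≤l)

take-++ʳ : ∀ {A : Set} (xs ys : List A) t → take (length xs + t) (xs ++ ys) ≡ xs ++ take t ys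
take-++ʳ []       ys t = refl
take-++ʳ (x ∷ xs) ys t = cong (x ∷_) (take-++ʳ xs ys t)

sum-take+drop : ∀ t xs → sum xs ≡ sum (take t xs) + sum (drop t xs)
sum-take+drop t xs = trans (cong sum (sym (take++drop≡id t xs))) (sum-++ (take t xs) (drop t xs))

linked-replicate : ∀ b {x y} → x ≤ y → Linked _≤_ (x ∷ replicate b y)
linked-replicate zero    _   = Linked.[-]
linked-replicate (suc b) x≤y = x≤y Linked.∷ linked-replicate b ≤-refl

ascending-++ : ∀ {x} xs ys → AscendingSeq xs → last xs ≡ just x → AscendingSeq (x ∷ ys) →
  AscendingSeq (xs ++ ys)
ascending-++ xs ys (xs>0 , xs↗) last≡ (_ All.∷ ys>0 , x∷ys↗) =
  Allₚ.++⁺ xs>0 ys>0 ,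
  Linkedₚ.++⁺ xs↗ (subst (λ m → Connected _≤_ m (head ys)) (sym last≡) (Linked.head′ x∷ys↗))
    (Linked.tail x∷ys↗)

last-positive : ∀ {x} xs → AscendingSeq xs → last xs ≡ just x → 0 < x
last-positive xs (xs>0 , _) last≡ =
  Maybe.drop-just (subst (Maybe.All (0 <_)) last≡ (Allₚ.last⁺ xs>0))

balanced : ℕ → ℕ → ℕ → List ℕ
balanced d b a = replicate d a ++ replicate b (suc a)

length-balanced : ∀ d b a → length (balanced d b a) ≡ d + b
length-balanced zero    b a = length-replicate b
length-balanced (suc d) b a = cong suc (length-balanced d b a)

sum-balanced : ∀ d b a → sum (balanced d b a) ≡ d * a + b * suc a
sum-balanced d b a = begin
  sum (replicate d a ++ replicate b (suc a))         ≡⟨ sum-++ (replicate d a) _ ⟩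
  sum (replicate d a) + sum (replicate b (suc a))    ≡⟨ cong₂ _+_ (sum-replicate d a) (sum-replicate b _) ⟩
  d * a + b * suc a                                  ∎
  where open ≡-Reasoning

take-balanced-≤ : ∀ t c b a → take t (balanced (t + c) b a) ≡ replicate t a
take-balanced-≤ zero    c b a = refl
take-balanced-≤ (suc t) c b a = cong (a ∷_) (take-balanced-≤ t c b a)

drop-balanced-≤ : ∀ t c b a → drop t (balanced (t + c) b a) ≡ balanced c b a
drop-balanced-≤ zero    c b a = refl
drop-balanced-≤ (suc t) c b a = drop-balanced-≤ t c b a

take-balanced-≥ : ∀ d e w a → take (d + e) (balanced d (e + w) a) ≡ balanced d e a
take-balanced-≥ zero    e w a = take-replicate e w (suc a)
take-balanced-≥ (suc d) e w a = cong (a ∷_) (take-balanced-≥ d e w a)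

drop-balanced-≥ : ∀ d e w a → drop (d + e) (balanced d (e + w) a) ≡ replicate w (suc a)
drop-balanced-≥ zero    e w a = drop-replicate e w (suc a)
drop-balanced-≥ (suc d) e w a = drop-balanced-≥ d e w a

balanced-deficit-≤ : ∀ t c b a → 0 < a →
  t * b * (t * a + (c * a + b * suc a) + 1) ≤ (t + c + b) * (t * a) * (c * a + b * suc a)
balanced-deficit-≤ t c b a 0<a = begin
  t * b * (t * a + (c * a + b * suc a) + 1)
    ≡⟨ solve (t ∷ c ∷ b ∷ a ∷ []) ⟩
  t * (t + c + b) * a * b + b * (t * (b + 1))
    ≤⟨ +-monoʳ-≤ (t * (t + c + b) * a * b) (*-monoʳ-≤ b (m*[n+1]≤m*[m+n] t b)) ⟩
  t * (t + c + b) * a * b + b * (t * (t + b))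
    ≤⟨ +-monoʳ-≤ (t * (t + c + b) * a * b) bt[t+b]≤ ⟩
  t * (t + c + b) * a * b + (c + b) * (t * (t + c + b)) * (a * a)
    ≡⟨ solve (t ∷ c ∷ b ∷ a ∷ []) ⟩
  (t + c + b) * (t * a) * (c * a + b * suc a) ∎
  where
  open ≤-Reasoning
  bt[t+b]≤ : b * (t * (t + b)) ≤ (c + b) * (t * (t + c + b)) * (a * a)
  bt[t+b]≤ = begin
    b * (t * (t + b))                     ≤⟨ *-mono-≤ (m≤n+m b c) (*-monoʳ-≤ t (+-monoˡ-≤ b (m≤m+n t c))) ⟩
    (c + b) * (t * (t + c + b))           ≡⟨ *-identityʳ _ ⟨
    (c + b) * (t * (t + c + b)) * 1       ≤⟨ *-monoʳ-≤ ((c + b) * (t * (t + c + b))) (*-mono-≤ 0<a 0<a) ⟩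
    (c + b) * (t * (t + c + b)) * (a * a) ∎

balanced-deficit-≥ : ∀ d e w a → 0 < a →
  d * w * (d * a + e * suc a + w * suc a + 1) ≤ (d + (e + w)) * (d * a + e * suc a) * (w * suc a)
balanced-deficit-≥ d e w a 0<a = begin
  d * w * (d * a + e * suc a + w * suc a + 1)
    ≡⟨ solve (d ∷ e ∷ w ∷ a ∷ []) ⟩
  w * (d * (d + (e + w)) * a + d * (e + w + 1))
    ≤⟨ *-monoʳ-≤ w (+-monoʳ-≤ (d * (d + (e + w)) * a) d[e+w+1]≤) ⟩
  w * (d * (d + (e + w)) * a + d * (d + (e + w)) * (a * a))
    ≡⟨ solve (d ∷ e ∷ w ∷ a ∷ []) ⟩
  w * ((d + (e + w)) * (d * a) * suc a)
    ≤⟨ *-monoʳ-≤ w (*-monoˡ-≤ (suc a) (*-monoʳ-≤ (d + (e + w)) (m≤m+n (d * a) (e * suc a)))) ⟩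
  w * ((d + (e + w)) * (d * a + e * suc a) * suc a)
    ≡⟨ solve (d ∷ e ∷ w ∷ a ∷ []) ⟩
  (d + (e + w)) * (d * a + e * suc a) * (w * suc a) ∎
  where
  open ≤-Reasoning
  d[e+w+1]≤ : d * (e + w + 1) ≤ d * (d + (e + w)) * (a * a)
  d[e+w+1]≤ = begin
    d * (e + w + 1)             ≤⟨ m*[n+1]≤m*[m+n] d (e + w) ⟩
    d * (d + (e + w))           ≡⟨ *-identityʳ _ ⟨
    d * (d + (e + w)) * 1       ≤⟨ *-monoʳ-≤ (d * (d + (e + w))) (*-mono-≤ 0<a 0<a) ⟩
    d * (d + (e + w)) * (a * a) ∎

balanced-aboveChord : ∀ d b a → 0 < a → AboveChord (balanced d b a)
balanced-aboveChord d b a 0<a t t≤len with t ≤? d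
... | yes t≤d with c , refl ← m≤n⇒∃[o]m+o≡n t≤d
  rewrite length-balanced (t + c) b a | take-balanced-≤ t c b a | drop-balanced-≤ t c b a
        | sum-replicate t a | sum-balanced c b a
  = chord-from-deficit {t} {t + c + b} {t * a} {c * a + b * suc a} {t * b}
      (solve (t ∷ c ∷ b ∷ a ∷ [])) (balanced-deficit-≤ t c b a 0<a)
... | no t≰d with e , refl ← m≤n⇒∃[o]m+o≡n (<⇒≤ (≰⇒> t≰d))
  rewrite length-balanced d b a
  with w , refl ← m≤n⇒∃[o]m+o≡n (+-cancelˡ-≤ d e b t≤len)
  rewrite take-balanced-≥ d e w a | drop-balanced-≥ d e w a
        | sum-balanced d e a | sum-replicate w (suc a)
  = chord-from-deficit {d + e} {d + (e + w)} {d * a + e * suc a} {w * suc a} {d * w}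
      (solve (d ∷ e ∷ w ∷ a ∷ [])) (balanced-deficit-≥ d e w a 0<a)

balanced-linked : ∀ d b {x a} → x ≤ a → Linked _≤_ (x ∷ balanced d b a)
balanced-linked zero    b x≤a = linked-replicate b (m≤n⇒m≤1+n x≤a)
balanced-linked (suc d) b x≤a = x≤a Linked.∷ balanced-linked d b ≤-refl

balanced-ascending : ∀ d b {x a} → 0 < x → x ≤ a → AscendingSeq (x ∷ balanced d b a)
balanced-ascending d b 0<x x≤a =
  0<x All.∷ Allₚ.++⁺ (Allₚ.replicate⁺ d (≤-trans 0<x x≤a)) (Allₚ.replicate⁺ b (s≤s z≤n)) ,
  balanced-linked d b x≤a

balancedTail : (M r : ℕ) .{{_ : NonZero M}} → List ℕ
balancedTail M r = balanced (M ∸ r % M) (r % M) (r / M)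

module _ (M r : ℕ) .{{_ : NonZero M}} where

  length-balancedTail : length (balancedTail M r) ≡ M
  length-balancedTail =
    trans (length-balanced (M ∸ r % M) (r % M) (r / M)) (m∸n+n≡m (<⇒≤ (m%n<n r M)))

  sum-balancedTail : sum (balancedTail M r) ≡ r
  sum-balancedTail = begin
    sum (balancedTail M r)                      ≡⟨ sum-balanced d b a ⟩
    d * a + b * suc a                           ≡⟨ regroup d b a ⟩
    b + (d + b) * a                             ≡⟨ cong (λ m → b + m * a) (m∸n+n≡m (<⇒≤ (m%n<n r M))) ⟩
    b + M * a                                   ≡⟨ cong (λ m → b + m) (*-comm M a) ⟩
    b + a * M                                   ≡⟨ m≡m%n+[m/n]*n r M ⟨
    r                                           ∎
    where
    open ≡-Reasoning
    a = r / M
    b = r % M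
    d = M ∸ b
    regroup : ∀ x y z → x * z + y * suc z ≡ y + (x + y) * z
    regroup = solve-∀

slackAt-++ˡ : ∀ n s {j} p q → j ≤ length p → slackAt n s (p ++ q) j ≡ slackAt n s p j
slackAt-++ˡ n s {j} p q j≤l = cong (λ ps → headSum n (sum ps) ℤ.- + j ℤ.* + s) (take-++ˡ j p q j≤l)

2ls≤twiceHeadSum : ∀ {n s} p r → n ≡ sum p + r →
  (∀ j → 1 ≤ j → j ≤ length p → + 0 ℤ.≤ slackAt n s p j) →
  2 * (length p * s) ≤ twiceHeadSum (sum p) r
2ls≤twiceHeadSum []          r _    _       = z≤n
2ls≤twiceHeadSum {s = s} p@(_ ∷ _) r refl slack-p =
  Equivalence.to (0≤headSum-js⇔ (sum p) r (length p) s)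
    (subst (λ ps → + 0 ℤ.≤ headSum (sum p + r) (sum ps) ℤ.- + length p ℤ.* + s)
      (take-all (length p) p ≤-refl) (slack-p (length p) (s≤s z≤n) ≤-refl))

slackAt-++ʳ-nonneg : ∀ {s} p q t → t < length q →
  2 * ((length p + length q) * s) ≡ (sum p + sum q) * (sum p + sum q + 1) →
  (∀ j → 1 ≤ j → j ≤ length p → + 0 ℤ.≤ slackAt (sum p + sum q) s p j) →
  AboveChord q →
  + 0 ℤ.≤ slackAt (sum p + sum q) s (p ++ q) (length p + t)
slackAt-++ʳ-nonneg {s} p q t t<M 2ks≡ slack-p chord =
  subst₂ (λ m i → + 0 ℤ.≤ headSum m i ℤ.- + (length p + t) ℤ.* + s) n≡ prefix≡
    (Equivalence.from (0≤headSum-js⇔ (A + u) v (length p + t) s)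
      (chord-interpolation {length p} {t} {length q} {s} {A} {u} {v}
        {{>-nonZero (≤-<-trans z≤n t<M)}} (<⇒≤ t<M)
        (2ls≤twiceHeadSum p (u + v) r≡ slack-p)
        (subst (λ m → 2 * ((length p + length q) * s) ≡ m * (m + 1)) r≡ 2ks≡)
        (chord t (<⇒≤ t<M))))
  where
  A = sum p
  u = sum (take t q)
  v = sum (drop t q)
  r≡ : A + sum q ≡ A + (u + v)
  r≡ = cong (λ m → A + m) (sum-take+drop t q)
  n≡ : A + u + v ≡ A + sum q
  n≡ = trans (+-assoc A u v) (sym r≡)
  prefix≡ : A + u ≡ sum (take (length p + t) (p ++ q))
  prefix≡ = sym (trans (cong sum (take-++ʳ p q t)) (sum-++ p (take t q)))

slackNonneg-++ : ∀ {n s} p q → n ≡ sum p + sum q →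
  2 * ((length p + length q) * s) ≡ n * (n + 1) →
  (∀ j → 1 ≤ j → j ≤ length p → + 0 ℤ.≤ slackAt n s p j) →
  AboveChord q →
  SlackNonneg n s (p ++ q)
slackNonneg-++ {s = s} p q refl 2ks≡ slack-p chord j 1≤j j<k with j ≤? length p
... | yes j≤l = subst (+ 0 ℤ.≤_) (sym (slackAt-++ˡ _ s p q j≤l)) (slack-p j 1≤j j≤l)
... | no j≰l with t , refl ← m≤n⇒∃[o]m+o≡n (<⇒≤ (≰⇒> j≰l)) =
  slackAt-++ʳ-nonneg p q t t<M 2ks≡ slack-p chord
  where
  t<M : t < length q
  t<M = +-cancelˡ-< (length p) t (length q) (subst (length p + t <_) (length-++ p) j<k)

lemma6p3 : (n k s : ℕ) → 0 ℕ.< n → 0 ℕ.< k → 2 ℕ.* k ℕ.* s ≡ n ℕ.* (n ℕ.+ 1) →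
    (p : List ℕ) (pₗ : ℕ) → last p ≡ just pₗ → AscendingSeq p → length p ℕ.< k →
    (+ (k ℕ.∸ length p) ℤ.* + pₗ ℤ.≤ + n ℤ.- + sum p) →
    (∀ j → 1 ℕ.≤ j → j ℕ.≤ length p → + 0 ℤ.≤ slackAt n s p j) →
    ∃ λ (q : List ℕ) → AscendingPartition n k (p ++ q) × SlackNonneg n s (p ++ q)
lemma6p3 n k s _ _ 2ks≡ p pₗ last≡ p↗ l<k room slack-p =
  q , (ascending-++ p q p↗ last≡ (balanced-ascending d b 0<pₗ pₗ≤a) ,
       trans (sum-++ p q) n≡ , trans (length-++ p) k≡) ,
  slackNonneg-++ p q (sym n≡) 2[l+M]s≡ slack-p (balanced-aboveChord d b a (≤-trans 0<pₗ pₗ≤a))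
  where
  M = k ∸ length p
  instance
    M≢0 : NonZero M
    M≢0 = >-nonZero (m<n⇒0<n∸m l<k)
  r = n ∸ sum p
  a = r / M
  b = r % M
  d = M ∸ b
  q = balancedTail M r
  Mpₗ+A≤n : M * pₗ + sum p ≤ n
  Mpₗ+A≤n = m≤n-o⇒m+o≤n (subst (ℤ._≤ _) (sym (ℤ.pos-* M pₗ)) room)
  n≡ : sum p + sum q ≡ n
  n≡ = trans (cong (λ m → sum p + m) (sum-balancedTail M r))
             (m+[n∸m]≡n (≤-trans (m≤n+m (sum p) (M * pₗ)) Mpₗ+A≤n))
  k≡ : length p + length q ≡ k
  k≡ = trans (cong (λ m → length p + m) (length-balancedTail M r)) (m+[n∸m]≡n (<⇒≤ l<k))
  2[l+M]s≡ : 2 * ((length p + length q) * s) ≡ n * (n + 1)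
  2[l+M]s≡ = trans (cong (λ m → 2 * (m * s)) k≡) (trans (sym (*-assoc 2 k s)) 2ks≡)
  0<pₗ : 0 < pₗ
  0<pₗ = last-positive p p↗ last≡
  pₗ≤a : pₗ ≤ a
  pₗ≤a = n*m≤o⇒m≤o/n pₗ M r (m+n≤o⇒m≤o∸n (M * pₗ) Mpₗ+A≤n)
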